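{- Every Hall triple system is strongly anti-pasch.
   Context: A Steiner triple system of order $n$ is a pair $(X,S)$ with $|X|=n$ and $S$ a set of 3-subsets of $X$ (blocks) such that every pair of distinct elements lies in exactly one block; the associated operation $\star$ has $a\star a=a$ and for $a\neq b$, $a\star b$ is the third element of the block containing $a,b$. A Hall triple system is a Steiner triple system in which any three distinct elements not forming a block generate a subsystem isomorphic to the unique Steiner triple system of order 9 (the affine plane $AG(2,3)$). Let $B(S)=\{\{a\star b,b\star c,c\star a\} : a,b,c\in X \text{ distinct}\}$ and $\beta(S)=|B(S)|$; $S$ of order $n$ is strongly anti-pasch if $\beta(S)=\binom{n}{3}$. -}

module Defs where

open import Data.Nat using (ℕ; _+_; _%_)
open import Data.Fin using (Fin; toℕ)
open import Data.Fin.Properties using () renaming (_≟_ to _≟ᶠ_)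
open import Data.Fin.Subset using (Subset; ⁅_⁆; _∪_; _∈_; ∣_∣)
open import Data.Bool.Properties using () renaming (_≟_ to _≟ᵇ_)
open import Data.Vec.Properties using (≡-dec)
open import Data.List using (List; allFin; concatMap; filter; map; deduplicate; length; [_]; [])
open import Data.Product using (Σ; ∃; _×_; _,_)
open import Relation.Nullary using (¬_; _×-dec_; ¬?)
open import Relation.Binary.PropositionalEquality using (_≡_; _≢_)
open import Function.Bundles using (_⇔_)

triple : ∀ {n} → Fin n → Fin n → Fin n → Subset n
triple x y z = ⁅ x ⁆ ∪ ⁅ y ⁆ ∪ ⁅ z ⁆

Distinct3 : ∀ {A : Set} → A → A → A → Set
Distinct3 a b c = (a ≢ b) × (b ≢ c) × (a ≢ c)

record STS (n : ℕ) : Set₁ where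
  field
    Block       : Subset n → Set
    block-size  : ∀ t → Block t → ∣ t ∣ ≡ 3
    pair-exists : ∀ (a b : Fin n) → a ≢ b → Σ (Subset n) λ t → Block t × a ∈ t × b ∈ t
    pair-unique : ∀ (a b : Fin n) → a ≢ b → ∀ t u →
                  Block t → a ∈ t → b ∈ t → Block u → a ∈ u → b ∈ u → t ≡ u
    _⋆_         : Fin n → Fin n → Fin n
    ⋆-idem      : ∀ a → a ⋆ a ≡ a
    ⋆-third     : ∀ (a b : Fin n) → a ≢ b → ∀ t → Block t → a ∈ t → b ∈ t →
                  (a ⋆ b) ∈ t × (a ⋆ b) ≢ a × (a ⋆ b) ≢ b

AGPoint : Set
AGPoint = Fin 3 × Fin 3

AGLine : AGPoint → AGPoint → AGPoint → Set
AGLine (p₁ , p₂) (q₁ , q₂) (r₁ , r₂) =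
  Distinct3 (p₁ , p₂) (q₁ , q₂) (r₁ , r₂) ×
  ((toℕ p₁ + toℕ q₁ + toℕ r₁) % 3 ≡ 0) ×
  ((toℕ p₂ + toℕ q₂ + toℕ r₂) % 3 ≡ 0)

module _ {n : ℕ} (S : STS n) where
  open STS S

  data Generated (a b c : Fin n) : Fin n → Set where
    gen-a : Generated a b c a
    gen-b : Generated a b c b
    gen-c : Generated a b c c
    gen-⋆ : ∀ {x y} → Generated a b c x → Generated a b c y → Generated a b c (x ⋆ y)

  GeneratesAG23 : Fin n → Fin n → Fin n → Set
  GeneratesAG23 a b c =
    Σ (AGPoint → Fin n) λ f →
      (∀ p q → f p ≡ f q → p ≡ q) ×
      (∀ x → Generated a b c x ⇔ ∃ λ p → f p ≡ x) ×
      (∀ p q r → Distinct3 p q r → (AGLine p q r ⇔ Block (triple (f p) (f q) (f r))))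

  IsHall : Set
  IsHall = ∀ a b c → Distinct3 a b c → ¬ Block (triple a b c) → GeneratesAG23 a b c

  -- B(S) = { {a⋆b, b⋆c, c⋆a} : a, b, c distinct }, as a duplicate-free list.
  distinctTriples : List (Fin n × Fin n × Fin n)
  distinctTriples =
    concatMap (λ a → concatMap (λ b → concatMap (λ c →
      filter (λ { (x , y , z) → ¬? (x ≟ᶠ y) ×-dec ¬? (y ≟ᶠ z) ×-dec ¬? (x ≟ᶠ z) })
             [ (a , b , c) ]) (allFin n)) (allFin n)) (allFin n)

  BList : List (Subset n)
  BList = deduplicate (≡-dec _≟ᵇ_)
            (map (λ { (a , b , c) → triple (a ⋆ b) (b ⋆ c) (c ⋆ a) }) distinctTriples)

  β : ℕ
  β = length BList

open import Data.Nat.Combinatorics using (_C_)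

StronglyAntiPasch : ∀ {n} → STS n → Set
StronglyAntiPasch {n} S = β S ≡ n C 3

-- Let a, b, c be distinct points and x = a ⋆ b, y = b ⋆ c, z = c ⋆ a. If {a, b, c} is a
-- block then {x, y, z} = {a, b, c}; otherwise, by the Hall property, a, b, c lie in a copy
-- of AG(2,3), where p ⋆ q = −(p + q) and everything reduces to a finite computation.
-- Either way x, y, z are distinct and (x ⋆ z) ⋆ y = a, and cyclically. So {a, b, c} is
-- recovered from {x, y, z} by a formula symmetric in x, y, z: the map
-- {a, b, c} ↦ {a ⋆ b, b ⋆ c, c ⋆ a} is injective on 3-subsets, and B(S) has n C 3 elements.
module Submission where

open import Defs
open import Data.Bool.Properties using () renaming (_≟_ to _≟ᵇ_)
open import Data.Empty using (⊥-elim)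
open import Data.Fin using (Fin; zero; suc; toℕ) renaming (_≟_ to _≟ᶠ_)
open import Data.Fin.Properties using (suc-injective; all?)
open import Data.Fin.Subset using (Subset; inside; outside; ⊥; ⁅_⁆; _∪_; _∈_; _∉_; _⊆_; ∣_∣)
open import Data.Fin.Subset.Properties
  using (x∈⁅x⁆; x∈⁅y⁆⇒x≡y; x≢y⇒x∉⁅y⁆; ∣⁅x⁆∣≡1; x∈p∪q⁻; x∈p∪q⁺; p⊆q⇒∣p∣≤∣q∣;
         ∪-assoc; ∪-comm; ∪-identityˡ; ∪-identityʳ; _∈?_)
open import Data.List as List using (List; []; _∷_; [_]; _++_; length; map; deduplicate; allFin)
open import Data.List.Membership.Propositional using () renaming (_∈_ to _∈ₗ_)
open import Data.List.Membership.Propositional.Properties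
  using (∈-map⁺; ∈-map⁻; ∈-++⁺ˡ; ∈-++⁺ʳ; ∈-++⁻; ∈-concatMap⁺; ∈-concatMap⁻; ∈-filter⁺; ∈-filter⁻;
         ∈-allFin; ∈-deduplicate⁺; ∈-deduplicate⁻)
open import Data.List.Membership.Propositional.Properties.WithK using (unique∧set⇒bag)
open import Data.List.Properties using (length-++; length-map)
open import Data.List.Relation.Binary.BagAndSetEquality using (∼bag⇒↭)
open import Data.List.Relation.Binary.Permutation.Propositional.Properties using (↭-length)
open import Data.List.Relation.Unary.All as All using ()
open import Data.List.Relation.Unary.All.Properties as All using ()
open import Data.List.Relation.Unary.AllPairs as AllPairs using (AllPairs)
open import Data.List.Relation.Unary.AllPairs.Properties as AllPairs using ()
open import Data.List.Relation.Unary.Any as Any using ()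
open import Data.List.Relation.Unary.Unique.DecPropositional.Properties using (deduplicate-!)
open import Data.List.Relation.Unary.Unique.Propositional as List using ()
open import Data.Nat using (ℕ; zero; suc; _+_; _*_; _≤_; _%_) renaming (_≟_ to _≟ℕ_)
open import Data.Nat.Combinatorics using (_C_; nCk+nC[k+1]≡[n+1]C[k+1])
open import Data.Nat.DivMod using (_mod_)
open import Data.Nat.Properties using (<-irrefl)
open import Data.Product using (∃; _×_; _,_; proj₁; proj₂)
open import Data.Product.Properties using () renaming (≡-dec to ×-≡-dec)
open import Data.Sum using (_⊎_; inj₁; inj₂)
open import Data.Unit using (tt)
open import Data.Vec as Vec using (Vec; []; _∷_; here; there)
open import Data.Vec.Properties using (∷-injectiveʳ; ≡-dec)
open import Data.Vec.Relation.Unary.All as VAll using ()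
open import Data.Vec.Relation.Unary.All.Properties as VAll using ()
open import Data.Vec.Relation.Unary.AllPairs as VAllPairs using ()
open import Data.Vec.Relation.Unary.Unique.Propositional using (Unique)
open import Data.Vec.Relation.Unary.Unique.Propositional.Properties as VUnique using ()
open import Function using (_∘′_)
open import Function.Bundles using (Equivalence; _⇔_; mk⇔)
open import Relation.Binary.Definitions using (DecidableEquality)
open import Relation.Binary.PropositionalEquality
  using (_≡_; _≢_; refl; sym; trans; cong; cong₂; subst; subst₂; module ≡-Reasoning)
open import Relation.Nullary using (Dec; yes; no; ¬?; _×-dec_; _→-dec_)
open import Relation.Nullary.Decidable using (map′; toWitness)
open import Relation.Unary using (Decidable)

private
  variable
    n k : ℕ
    a b c x : Fin n

∈-triple⁻ : x ∈ triple a b c → x ≡ a ⊎ x ≡ b ⊎ x ≡ c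
∈-triple⁻ {a = a} {b} {c} x∈ with x∈p∪q⁻ ⁅ a ⁆ (⁅ b ⁆ ∪ ⁅ c ⁆) x∈
... | inj₁ x∈a = inj₁ (x∈⁅y⁆⇒x≡y a x∈a)
... | inj₂ x∈bc with x∈p∪q⁻ ⁅ b ⁆ ⁅ c ⁆ x∈bc
...   | inj₁ x∈b = inj₂ (inj₁ (x∈⁅y⁆⇒x≡y b x∈b))
...   | inj₂ x∈c = inj₂ (inj₂ (x∈⁅y⁆⇒x≡y c x∈c))

∈-triple⁺ : x ≡ a ⊎ x ≡ b ⊎ x ≡ c → x ∈ triple a b c
∈-triple⁺ {x = x}         (inj₁ refl)        = x∈p∪q⁺ (inj₁ (x∈⁅x⁆ x))
∈-triple⁺ {x = x} {a}     (inj₂ (inj₁ refl)) = x∈p∪q⁺ {p = ⁅ a ⁆} (inj₂ (x∈p∪q⁺ (inj₁ (x∈⁅x⁆ x))))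
∈-triple⁺ {x = x} {a} {b} (inj₂ (inj₂ refl)) = x∈p∪q⁺ {p = ⁅ a ⁆} (inj₂ (x∈p∪q⁺ {p = ⁅ b ⁆} (inj₂ (x∈⁅x⁆ x))))

triple⊆ : ∀ {t : Subset n} → a ∈ t → b ∈ t → c ∈ t → triple a b c ⊆ t
triple⊆ a∈t b∈t c∈t x∈ with ∈-triple⁻ x∈
... | inj₁ refl        = a∈t
... | inj₂ (inj₁ refl) = b∈t
... | inj₂ (inj₂ refl) = c∈t

∣⁅x⁆∪p∣≡1+∣p∣ : ∀ {p : Subset n} → x ∉ p → ∣ ⁅ x ⁆ ∪ p ∣ ≡ suc ∣ p ∣
∣⁅x⁆∪p∣≡1+∣p∣ {x = zero}  {outside ∷ p} _   = cong suc (cong ∣_∣ (∪-identityˡ p))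
∣⁅x⁆∪p∣≡1+∣p∣ {x = zero}  {inside  ∷ p} x∉p = ⊥-elim (x∉p here)
∣⁅x⁆∪p∣≡1+∣p∣ {x = suc x} {outside ∷ p} x∉p = ∣⁅x⁆∪p∣≡1+∣p∣ (x∉p ∘′ there)
∣⁅x⁆∪p∣≡1+∣p∣ {x = suc x} {inside  ∷ p} x∉p = cong suc (∣⁅x⁆∪p∣≡1+∣p∣ (x∉p ∘′ there))

∣triple∣≡3 : Distinct3 a b c → ∣ triple a b c ∣ ≡ 3
∣triple∣≡3 {a = a} {b} {c} (a≢b , b≢c , a≢c) = begin
  ∣ ⁅ a ⁆ ∪ ⁅ b ⁆ ∪ ⁅ c ⁆ ∣ ≡⟨ ∣⁅x⁆∪p∣≡1+∣p∣ a∉bc ⟩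
  suc ∣ ⁅ b ⁆ ∪ ⁅ c ⁆ ∣     ≡⟨ cong suc (∣⁅x⁆∪p∣≡1+∣p∣ (x≢y⇒x∉⁅y⁆ b≢c)) ⟩
  suc (suc ∣ ⁅ c ⁆ ∣)       ≡⟨ cong (suc ∘′ suc) (∣⁅x⁆∣≡1 c) ⟩
  3                         ∎
  where
  open ≡-Reasoning
  a∉bc : a ∉ ⁅ b ⁆ ∪ ⁅ c ⁆
  a∉bc a∈bc with x∈p∪q⁻ ⁅ b ⁆ ⁅ c ⁆ a∈bc
  ... | inj₁ a∈b = a≢b (x∈⁅y⁆⇒x≡y b a∈b)
  ... | inj₂ a∈c = a≢c (x∈⁅y⁆⇒x≡y c a∈c)

-- A fourth element w ∉ {a, b, c} of t would make ⁅ w ⁆ ∪ triple a b c ⊆ t of size 4.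
∣t∣≡3⇒t⊆triple : ∀ {t : Subset n} → ∣ t ∣ ≡ 3 → Distinct3 a b c →
                 a ∈ t → b ∈ t → c ∈ t → t ⊆ triple a b c
∣t∣≡3⇒t⊆triple {a = a} {b} {c} {t} ∣t∣≡3 abc a∈t b∈t c∈t {w} w∈t with w ∈? triple a b c
... | yes w∈abc = w∈abc
... | no  w∉abc = ⊥-elim (<-irrefl refl (subst (4 ≤_) ∣t∣≡3 (subst (_≤ ∣ t ∣) ∣wabc∣≡4 (p⊆q⇒∣p∣≤∣q∣ wabc⊆t))))
  where
  ∣wabc∣≡4 : ∣ ⁅ w ⁆ ∪ triple a b c ∣ ≡ 4
  ∣wabc∣≡4 = trans (∣⁅x⁆∪p∣≡1+∣p∣ w∉abc) (cong suc (∣triple∣≡3 abc))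
  wabc⊆t : ⁅ w ⁆ ∪ triple a b c ⊆ t
  wabc⊆t y∈ with x∈p∪q⁻ ⁅ w ⁆ _ y∈
  ... | inj₁ y∈w   = subst (_∈ t) (sym (x∈⁅y⁆⇒x≡y w y∈w)) w∈t
  ... | inj₂ y∈abc = triple⊆ a∈t b∈t c∈t y∈abc

triple-cong : ∀ {a b c a′ b′ c′ : Fin n} → a ≡ a′ → b ≡ b′ → c ≡ c′ → triple a b c ≡ triple a′ b′ c′
triple-cong refl refl refl = refl

triple-rotate : (a b c : Fin n) → triple a b c ≡ triple b c a
triple-rotate a b c = begin
  ⁅ a ⁆ ∪ (⁅ b ⁆ ∪ ⁅ c ⁆) ≡⟨ ∪-comm ⁅ a ⁆ _ ⟩
  (⁅ b ⁆ ∪ ⁅ c ⁆) ∪ ⁅ a ⁆ ≡⟨ ∪-assoc ⁅ b ⁆ ⁅ c ⁆ ⁅ a ⁆ ⟩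
  ⁅ b ⁆ ∪ (⁅ c ⁆ ∪ ⁅ a ⁆) ∎
  where open ≡-Reasoning

triple-swap : (a b c : Fin n) → triple a b c ≡ triple b a c
triple-swap a b c = begin
  ⁅ a ⁆ ∪ (⁅ b ⁆ ∪ ⁅ c ⁆) ≡⟨ ∪-assoc ⁅ a ⁆ ⁅ b ⁆ ⁅ c ⁆ ⟨
  (⁅ a ⁆ ∪ ⁅ b ⁆) ∪ ⁅ c ⁆ ≡⟨ cong (_∪ ⁅ c ⁆) (∪-comm ⁅ a ⁆ ⁅ b ⁆) ⟩
  (⁅ b ⁆ ∪ ⁅ a ⁆) ∪ ⁅ c ⁆ ≡⟨ ∪-assoc ⁅ b ⁆ ⁅ a ⁆ ⁅ c ⁆ ⟩
  ⁅ b ⁆ ∪ (⁅ a ⁆ ∪ ⁅ c ⁆) ∎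
  where open ≡-Reasoning

triple-swap₂₃ : (a b c : Fin n) → triple a b c ≡ triple a c b
triple-swap₂₃ a b c = cong (⁅ a ⁆ ∪_) (∪-comm ⁅ b ⁆ ⁅ c ⁆)

Symmetric3 : {A B : Set} → (A → A → A → B) → Set
Symmetric3 G = (∀ a b c → G a b c ≡ G b c a) × (∀ a b c → G a b c ≡ G b a c)

-- Locating a′, b′, c′ among a, b, c leaves only the six bijective assignments.
symmetric-respects-triple : {B : Set} {G : Fin n → Fin n → Fin n → B} → Symmetric3 G →
  ∀ {a b c a′ b′ c′} → Distinct3 a′ b′ c′ → triple a b c ≡ triple a′ b′ c′ → G a b c ≡ G a′ b′ c′
symmetric-respects-triple {G = G} (rot , swap) {a} {b} {c} {a′} {b′} {c′} (a′≢b′ , b′≢c′ , a′≢c′) abc≡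
  with ∈-triple⁻ (locate (inj₁ refl)) | ∈-triple⁻ (locate (inj₂ (inj₁ refl))) | ∈-triple⁻ (locate (inj₂ (inj₂ refl)))
  where
  locate : ∀ {x} → x ≡ a′ ⊎ x ≡ b′ ⊎ x ≡ c′ → x ∈ triple a b c
  locate x∈ = subst (_ ∈_) (sym abc≡) (∈-triple⁺ x∈)
... | inj₁ refl        | inj₁ refl        | _                = ⊥-elim (a′≢b′ refl)
... | inj₂ (inj₁ refl) | inj₂ (inj₁ refl) | _                = ⊥-elim (a′≢b′ refl)
... | inj₂ (inj₂ refl) | inj₂ (inj₂ refl) | _                = ⊥-elim (a′≢b′ refl)
... | _                | inj₁ refl        | inj₁ refl        = ⊥-elim (b′≢c′ refl)
... | _                | inj₂ (inj₁ refl) | inj₂ (inj₁ refl) = ⊥-elim (b′≢c′ refl)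
... | _                | inj₂ (inj₂ refl) | inj₂ (inj₂ refl) = ⊥-elim (b′≢c′ refl)
... | inj₁ refl        | _                | inj₁ refl        = ⊥-elim (a′≢c′ refl)
... | inj₂ (inj₁ refl) | _                | inj₂ (inj₁ refl) = ⊥-elim (a′≢c′ refl)
... | inj₂ (inj₂ refl) | _                | inj₂ (inj₂ refl) = ⊥-elim (a′≢c′ refl)
... | inj₁ refl        | inj₂ (inj₁ refl) | inj₂ (inj₂ refl) = refl
... | inj₁ refl        | inj₂ (inj₂ refl) | inj₂ (inj₁ refl) = trans (rot a b c) (trans (rot b c a) (swap c a b))
... | inj₂ (inj₁ refl) | inj₁ refl        | inj₂ (inj₂ refl) = swap a b c
... | inj₂ (inj₁ refl) | inj₂ (inj₂ refl) | inj₁ refl        = rot a b c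
... | inj₂ (inj₂ refl) | inj₁ refl        | inj₂ (inj₁ refl) = trans (rot a b c) (rot b c a)
... | inj₂ (inj₂ refl) | inj₂ (inj₁ refl) | inj₁ refl        = trans (rot a b c) (swap b c a)

toSubset : Vec (Fin n) k → Subset n
toSubset = Vec.foldr _ (λ x s → ⁅ x ⁆ ∪ s) ⊥

toSubset-map-suc : (v : Vec (Fin n) k) → toSubset (Vec.map suc v) ≡ outside ∷ toSubset v
toSubset-map-suc []      = refl
toSubset-map-suc (x ∷ v) = cong (⁅ suc x ⁆ ∪_) (toSubset-map-suc v)

toSubset-cons-zero : (v : Vec (Fin n) k) → toSubset (zero ∷ Vec.map suc v) ≡ inside ∷ toSubset v
toSubset-cons-zero v = begin
  ⁅ zero ⁆ ∪ toSubset (Vec.map suc v) ≡⟨ cong (⁅ zero ⁆ ∪_) (toSubset-map-suc v) ⟩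
  inside ∷ (⊥ ∪ toSubset v)           ≡⟨ cong (inside ∷_) (∪-identityˡ (toSubset v)) ⟩
  inside ∷ toSubset v                 ∎
  where open ≡-Reasoning

toSubset-triple : (a b c : Fin n) → toSubset (a ∷ b ∷ c ∷ []) ≡ triple a b c
toSubset-triple a b c = cong (λ s → ⁅ a ⁆ ∪ ⁅ b ⁆ ∪ s) (∪-identityʳ ⁅ c ⁆)

Unique⇒Distinct3 : Unique (a ∷ b ∷ c ∷ []) → Distinct3 a b c
Unique⇒Distinct3 ((a≢b VAll.∷ a≢c VAll.∷ VAll.[]) VAllPairs.∷ (b≢c VAll.∷ VAll.[]) VAllPairs.∷ _) = a≢b , b≢c , a≢c

-- Each k-element subset of Fin n, listed once as its increasing enumeration.
combinations : ∀ k n → List (Vec (Fin n) k)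
combinations zero    _       = [ [] ]
combinations (suc k) zero    = []
combinations (suc k) (suc n) =
  map (λ v → zero ∷ Vec.map suc v) (combinations k n) ++ map (Vec.map suc) (combinations (suc k) n)

length-combinations : ∀ k n → length (combinations k n) ≡ n C k
length-combinations zero    _       = refl
length-combinations (suc k) zero    = refl
length-combinations (suc k) (suc n) = begin
  length (map _ (combinations k n) ++ map _ (combinations (suc k) n))
    ≡⟨ length-++ (map _ (combinations k n)) ⟩
  length (map _ (combinations k n)) + length (map _ (combinations (suc k) n))
    ≡⟨ cong₂ _+_ (length-map _ (combinations k n)) (length-map _ (combinations (suc k) n)) ⟩
  length (combinations k n) + length (combinations (suc k) n)
    ≡⟨ cong₂ _+_ (length-combinations k n) (length-combinations (suc k) n) ⟩
  n C k + n C suc k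
    ≡⟨ nCk+nC[k+1]≡[n+1]C[k+1] n k ⟩
  suc n C suc k ∎
  where open ≡-Reasoning

map-suc-∈-combinations : ∀ {n k} {v : Vec (Fin n) k} →
                         v ∈ₗ combinations k n → Vec.map suc v ∈ₗ combinations k (suc n)
map-suc-∈-combinations {k = zero} {v = []} _ = Any.here refl
map-suc-∈-combinations {n} {suc k} v∈ = ∈-++⁺ʳ (map _ (combinations k n)) (∈-map⁺ (Vec.map suc) v∈)

combinations-complete : (p : Subset n) → ∣ p ∣ ≡ k → ∃ λ v → v ∈ₗ combinations k n × toSubset v ≡ p
combinations-complete []            refl = [] , Any.here refl , refl
combinations-complete (inside ∷ p)  refl with combinations-complete p refl
... | v , v∈ , v≡p =
  zero ∷ Vec.map suc v , ∈-++⁺ˡ (∈-map⁺ _ v∈) , trans (toSubset-cons-zero v) (cong (inside ∷_) v≡p)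
combinations-complete (outside ∷ p) refl with combinations-complete p refl
... | v , v∈ , v≡p =
  Vec.map suc v , map-suc-∈-combinations v∈ , trans (toSubset-map-suc v) (cong (outside ∷_) v≡p)

combinations-toSubset-unique : ∀ k n → AllPairs (λ u v → toSubset u ≢ toSubset v) (combinations k n)
combinations-toSubset-unique zero    _       = All.[] AllPairs.∷ AllPairs.[]
combinations-toSubset-unique (suc k) zero    = AllPairs.[]
combinations-toSubset-unique (suc k) (suc n) = AllPairs.++⁺
  (AllPairs.map⁺ (AllPairs.map (λ {u} {v} u≢v → ≢-by (toSubset-cons-zero u) (toSubset-cons-zero v) (u≢v ∘′ ∷-injectiveʳ))
                               (combinations-toSubset-unique k n)))
  (AllPairs.map⁺ (AllPairs.map (λ {u} {v} u≢v → ≢-by (toSubset-map-suc u) (toSubset-map-suc v) (u≢v ∘′ ∷-injectiveʳ))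
                               (combinations-toSubset-unique (suc k) n)))
  (All.map⁺ (All.universal (λ u → All.map⁺ (All.universal (λ v → ≢-by (toSubset-cons-zero u) (toSubset-map-suc v) λ ()) _)) _))
  where
  ≢-by : ∀ {A : Set} {x x′ y y′ : A} → x ≡ x′ → y ≡ y′ → x′ ≢ y′ → x ≢ y
  ≢-by x≡x′ y≡y′ = subst₂ _≢_ (sym x≡x′) (sym y≡y′)

combinations-Unique : ∀ {n k} {v : Vec (Fin n) k} → v ∈ₗ combinations k n → Unique v
combinations-Unique {k = zero} {v = []} _ = VAllPairs.[]
combinations-Unique {suc n} {suc k} v∈ with ∈-++⁻ (map _ (combinations k n)) v∈
... | inj₁ v∈₁ with ∈-map⁻ _ v∈₁
...   | u , u∈ , refl = VAll.map⁺ (VAll.universal (λ _ ()) u) VAllPairs.∷ VUnique.map⁺ suc-injective (combinations-Unique u∈)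
combinations-Unique {suc n} {suc k} v∈ | inj₂ v∈₂ with ∈-map⁻ _ v∈₂
...   | u , u∈ , refl = VUnique.map⁺ suc-injective (combinations-Unique u∈)

length-deduplicate : {A : Set} (_≟_ : DecidableEquality A) {xs ys : List A} →
  (∀ {z} → z ∈ₗ xs ⇔ z ∈ₗ ys) → List.Unique ys → length (deduplicate _≟_ xs) ≡ length ys
length-deduplicate _≟_ {xs} xs≈ys ys-unique =
  ↭-length (∼bag⇒↭ (unique∧set⇒bag (deduplicate-! _≟_ xs) ys-unique
    (mk⇔ (Equivalence.to xs≈ys ∘′ ∈-deduplicate⁻ _≟_ xs) (∈-deduplicate⁺ _≟_ ∘′ Equivalence.from xs≈ys))))

AllPairs-map-∈ : {A : Set} {R S : A → A → Set} {xs : List A} →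
  (∀ {x y} → x ∈ₗ xs → y ∈ₗ xs → R x y → S x y) → AllPairs R xs → AllPairs S xs
AllPairs-map-∈ R⇒S AllPairs.[] = AllPairs.[]
AllPairs-map-∈ R⇒S (Rx AllPairs.∷ Rxs) =
  All.tabulate (λ y∈ → R⇒S (Any.here refl) (Any.there y∈) (All.lookup Rx y∈))
  AllPairs.∷ AllPairs-map-∈ (λ x∈ y∈ → R⇒S (Any.there x∈) (Any.there y∈)) Rxs

-- The third point on the line of AG(2,3) through p ≠ q is −(p + q) = 2(p + q).
_·_ : AGPoint → AGPoint → AGPoint
(p₁ , p₂) · (q₁ , q₂) = (2 * (toℕ p₁ + toℕ q₁)) mod 3 , (2 * (toℕ p₂ + toℕ q₂)) mod 3

infixl 7 _·_
infix 4 _≟ᴾ_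

_≟ᴾ_ : (p q : AGPoint) → Dec (p ≡ q)
_≟ᴾ_ = ×-≡-dec _≟ᶠ_ _≟ᶠ_

AGLine? : ∀ p q r → Dec (AGLine p q r)
AGLine? p@(p₁ , p₂) q@(q₁ , q₂) r@(r₁ , r₂) =
  (¬? (p ≟ᴾ q) ×-dec ¬? (q ≟ᴾ r) ×-dec ¬? (p ≟ᴾ r)) ×-dec
  ((toℕ p₁ + toℕ q₁ + toℕ r₁) % 3 ≟ℕ 0) ×-dec ((toℕ p₂ + toℕ q₂ + toℕ r₂) % 3 ≟ℕ 0)

∀ᴾ? : {P : AGPoint → Set} → Decidable P → Dec (∀ p → P p)
∀ᴾ? P? = map′ (λ ∀xy (x , y) → ∀xy x y) (λ ∀p x y → ∀p (x , y)) (all? λ x → all? λ y → P? (x , y))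

·-line : ∀ p q → p ≢ q → AGLine p q (p · q)
·-line = toWitness {a? = ∀ᴾ? λ p → ∀ᴾ? λ q → ¬? (p ≟ᴾ q) →-dec AGLine? p q (p · q)} tt

·-idem : ∀ p → p · p ≡ p
·-idem = toWitness {a? = ∀ᴾ? λ p → p · p ≟ᴾ p} tt

·-recover : ∀ p q r → (p · q) · (r · p) · (q · r) ≡ p
·-recover = toWitness {a? = ∀ᴾ? λ p → ∀ᴾ? λ q → ∀ᴾ? λ r → (p · q) · (r · p) · (q · r) ≟ᴾ p} tt

·-distinct : ∀ p q r → p ≢ r → p · q ≢ q · r
·-distinct = toWitness {a? = ∀ᴾ? λ p → ∀ᴾ? λ q → ∀ᴾ? λ r → ¬? (p ≟ᴾ r) →-dec ¬? (p · q ≟ᴾ q · r)} tt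

module _ {n} (S : STS n) where
  open STS S

  ⋆-unique : ∀ {a b w t} → a ≢ b → Block t → a ∈ t → b ∈ t → w ∈ t → w ≢ a → w ≢ b → a ⋆ b ≡ w
  ⋆-unique {a} {b} {w} a≢b Bt a∈t b∈t w∈t w≢a w≢b with ⋆-third a b a≢b _ Bt a∈t b∈t
  ... | ab∈t , ab≢a , ab≢b
    with ∈-triple⁻ (∣t∣≡3⇒t⊆triple (block-size _ Bt) (a≢b , ab≢b ∘′ sym , ab≢a ∘′ sym) a∈t b∈t ab∈t w∈t)
  ...   | inj₁ w≡a         = ⊥-elim (w≢a w≡a)
  ...   | inj₂ (inj₁ w≡b)  = ⊥-elim (w≢b w≡b)
  ...   | inj₂ (inj₂ w≡ab) = sym w≡ab

  ⋆-comm : ∀ a b → a ⋆ b ≡ b ⋆ a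
  ⋆-comm a b with a ≟ᶠ b
  ... | yes refl = refl
  ... | no a≢b with pair-exists a b a≢b
  ...   | t , Bt , a∈t , b∈t with ⋆-third b a (a≢b ∘′ sym) t Bt b∈t a∈t
  ...     | ba∈t , ba≢b , ba≢a = ⋆-unique a≢b Bt a∈t b∈t ba∈t ba≢a ba≢b

  block⇒⋆ : ∀ {a b c} → Distinct3 a b c → Block (triple a b c) → a ⋆ b ≡ c
  block⇒⋆ (a≢b , b≢c , a≢c) B =
    ⋆-unique a≢b B (∈-triple⁺ (inj₁ refl)) (∈-triple⁺ (inj₂ (inj₁ refl))) (∈-triple⁺ (inj₂ (inj₂ refl)))
             (a≢c ∘′ sym) (b≢c ∘′ sym)

  ⋆-cycle : ∀ {a b c} → Distinct3 a b c → a ⋆ b ≡ c → b ⋆ c ≡ a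
  ⋆-cycle {a} {b} {c} (a≢b , b≢c , a≢c) ab≡c with pair-exists a b a≢b
  ... | t , Bt , a∈t , b∈t with ⋆-third a b a≢b t Bt a∈t b∈t
  ...   | ab∈t , _ = ⋆-unique b≢c Bt b∈t (subst (_∈ t) ab≡c ab∈t) a∈t a≢b a≢c

  Recovers : Fin n → Fin n → Fin n → Set
  Recovers a b c = Distinct3 (a ⋆ b) (b ⋆ c) (c ⋆ a) × ((a ⋆ b) ⋆ (c ⋆ a)) ⋆ (b ⋆ c) ≡ a

  block-recovers : ∀ {a b c} → Distinct3 a b c → a ⋆ b ≡ c → Recovers a b c
  block-recovers {a} {b} {c} abc@(a≢b , b≢c , a≢c) ab≡c = distinct , recover
    where
    bc≡a : b ⋆ c ≡ a
    bc≡a = ⋆-cycle abc ab≡c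
    ca≡b : c ⋆ a ≡ b
    ca≡b = ⋆-cycle (b≢c , a≢c ∘′ sym , a≢b ∘′ sym) bc≡a
    distinct : Distinct3 (a ⋆ b) (b ⋆ c) (c ⋆ a)
    distinct = subst₂ _≢_ (sym ab≡c) (sym bc≡a) (a≢c ∘′ sym)
             , subst₂ _≢_ (sym bc≡a) (sym ca≡b) a≢b
             , subst₂ _≢_ (sym ab≡c) (sym ca≡b) (b≢c ∘′ sym)
    recover : ((a ⋆ b) ⋆ (c ⋆ a)) ⋆ (b ⋆ c) ≡ a
    recover = begin
      ((a ⋆ b) ⋆ (c ⋆ a)) ⋆ (b ⋆ c) ≡⟨ cong₂ _⋆_ (cong₂ _⋆_ ab≡c ca≡b) bc≡a ⟩
      (c ⋆ b) ⋆ a                   ≡⟨ cong (_⋆ a) (trans (⋆-comm c b) bc≡a) ⟩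
      a ⋆ a                         ≡⟨ ⋆-idem a ⟩
      a                             ∎
      where open ≡-Reasoning

  module _ (f : AGPoint → Fin n) (f-injective : ∀ p q → f p ≡ f q → p ≡ q)
           (f-block : ∀ p q r → Distinct3 p q r → AGLine p q r → Block (triple (f p) (f q) (f r))) where

    f-≢ : ∀ {p q} → p ≢ q → f p ≢ f q
    f-≢ p≢q = p≢q ∘′ f-injective _ _

    ⋆-image : ∀ p q → f p ⋆ f q ≡ f (p · q)
    ⋆-image p q with p ≟ᴾ q
    ... | yes refl = trans (⋆-idem (f p)) (cong f (sym (·-idem p)))
    ... | no  p≢q with ·-line p q p≢q
    ...   | line@(pq·@(_ , q≢pq , p≢pq) , _) =
      block⇒⋆ (f-≢ p≢q , f-≢ q≢pq , f-≢ p≢pq) (f-block p q (p · q) pq· line)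

    image-recovers : ∀ {p q r} → Distinct3 p q r → Recovers (f p) (f q) (f r)
    image-recovers {p} {q} {r} (p≢q , q≢r , p≢r) = distinct , recover
      where
      image-≢ : ∀ {p q r s} → p · q ≢ r · s → f p ⋆ f q ≢ f r ⋆ f s
      image-≢ {p} {q} {r} {s} = subst₂ _≢_ (sym (⋆-image p q)) (sym (⋆-image r s)) ∘′ f-≢
      distinct : Distinct3 (f p ⋆ f q) (f q ⋆ f r) (f r ⋆ f p)
      distinct = image-≢ (·-distinct p q r p≢r)
               , image-≢ (·-distinct q r p (p≢q ∘′ sym))
               , image-≢ (·-distinct r p q (q≢r ∘′ sym) ∘′ sym)
      recover : ((f p ⋆ f q) ⋆ (f r ⋆ f p)) ⋆ (f q ⋆ f r) ≡ f p
      recover = begin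
        ((f p ⋆ f q) ⋆ (f r ⋆ f p)) ⋆ (f q ⋆ f r) ≡⟨ cong₂ _⋆_ (cong₂ _⋆_ (⋆-image p q) (⋆-image r p)) (⋆-image q r) ⟩
        (f (p · q) ⋆ f (r · p)) ⋆ f (q · r)       ≡⟨ cong (_⋆ f (q · r)) (⋆-image (p · q) (r · p)) ⟩
        f ((p · q) · (r · p)) ⋆ f (q · r)         ≡⟨ ⋆-image ((p · q) · (r · p)) (q · r) ⟩
        f ((p · q) · (r · p) · (q · r))           ≡⟨ cong f (·-recover p q r) ⟩
        f p                                       ∎
        where open ≡-Reasoning

  hall-recovers : IsHall S → ∀ {a b c} → Distinct3 a b c → Recovers a b c
  hall-recovers hall {a} {b} {c} abc@(a≢b , b≢c , a≢c) with a ⋆ b ≟ᶠ c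
  ... | yes ab≡c = block-recovers abc ab≡c
  ... | no  ab≢c with hall a b c abc (ab≢c ∘′ block⇒⋆ abc)
  ...   | f , f-injective , generated , blocks
    with Equivalence.to (generated a) gen-a | Equivalence.to (generated b) gen-b | Equivalence.to (generated c) gen-c
  ...   | p , refl | q , refl | r , refl =
    image-recovers f f-injective (λ p q r pqr → Equivalence.to (blocks p q r pqr))
                   (a≢b ∘′ cong f , b≢c ∘′ cong f , a≢c ∘′ cong f)

  derivedTriple : Fin n → Fin n → Fin n → Subset n
  derivedTriple a b c = triple (a ⋆ b) (b ⋆ c) (c ⋆ a)

  derivedTriple-symmetric : Symmetric3 derivedTriple
  derivedTriple-symmetric = rotate , swap
    where
    rotate : ∀ a b c → derivedTriple a b c ≡ derivedTriple b c a
    rotate a b c = triple-rotate (a ⋆ b) (b ⋆ c) (c ⋆ a)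
    swap : ∀ a b c → derivedTriple a b c ≡ derivedTriple b a c
    swap a b c = trans (triple-swap₂₃ (a ⋆ b) (b ⋆ c) (c ⋆ a))
                       (triple-cong (⋆-comm a b) (⋆-comm c a) (⋆-comm b c))

  recoveredTriple : Fin n → Fin n → Fin n → Subset n
  recoveredTriple x y z = triple ((x ⋆ z) ⋆ y) ((y ⋆ x) ⋆ z) ((z ⋆ y) ⋆ x)

  recoveredTriple-symmetric : Symmetric3 recoveredTriple
  recoveredTriple-symmetric = rotate , swap
    where
    rotate : ∀ x y z → recoveredTriple x y z ≡ recoveredTriple y z x
    rotate x y z = triple-rotate ((x ⋆ z) ⋆ y) ((y ⋆ x) ⋆ z) ((z ⋆ y) ⋆ x)
    swap : ∀ x y z → recoveredTriple x y z ≡ recoveredTriple y x z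
    swap x y z = begin
      triple X Y Z ≡⟨ triple-rotate X Y Z ⟩
      triple Y Z X ≡⟨ triple-swap Y Z X ⟩
      triple Z Y X ≡⟨ triple-cong (cong (_⋆ x) (⋆-comm z y)) (cong (_⋆ z) (⋆-comm y x)) (cong (_⋆ y) (⋆-comm x z)) ⟩
      recoveredTriple y x z ∎
      where
      open ≡-Reasoning
      X = (x ⋆ z) ⋆ y
      Y = (y ⋆ x) ⋆ z
      Z = (z ⋆ y) ⋆ x

  derivedTripleᵗ : Fin n × Fin n × Fin n → Subset n
  derivedTripleᵗ (a , b , c) = derivedTriple a b c

  derivedTripleᵛ : Vec (Fin n) 3 → Subset n
  derivedTripleᵛ (a ∷ b ∷ c ∷ []) = derivedTriple a b c

  -- Definitionally the filter predicate of distinctTriples, which is what lets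
  -- ∈-filter⁻ and ∈-filter⁺ unfold that list.
  distinct3? : (t : Fin n × Fin n × Fin n) → Dec (Distinct3 (proj₁ t) (proj₁ (proj₂ t)) (proj₂ (proj₂ t)))
  distinct3? (x , y , z) = ¬? (x ≟ᶠ y) ×-dec ¬? (y ≟ᶠ z) ×-dec ¬? (x ≟ᶠ z)

  ∈-distinctTriples⁻ : ∀ {a b c} → (a , b , c) ∈ₗ distinctTriples S → Distinct3 a b c
  ∈-distinctTriples⁻ t∈ with Any.satisfied (∈-concatMap⁻ _ {xs = allFin n} t∈)
  ... | a , t∈a with Any.satisfied (∈-concatMap⁻ _ {xs = allFin n} t∈a)
  ... | b , t∈ab with Any.satisfied (∈-concatMap⁻ _ {xs = allFin n} t∈ab)
  ... | c , t∈abc with ∈-filter⁻ distinct3? {xs = [ (a , b , c) ]} t∈abc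
  ... | Any.here refl , abc = abc

  ∈-distinctTriples⁺ : ∀ {a b c} → Distinct3 a b c → (a , b , c) ∈ₗ distinctTriples S
  ∈-distinctTriples⁺ {a} {b} {c} abc =
    ∈-concatMap⁺ _ {xs = allFin n} (Any.map (λ { refl →
      ∈-concatMap⁺ _ {xs = allFin n} (Any.map (λ { refl →
        ∈-concatMap⁺ _ {xs = allFin n} (Any.map (λ { refl →
          ∈-filter⁺ distinct3? (Any.here refl) abc }) (∈-allFin c)) }) (∈-allFin b)) }) (∈-allFin a))

  derivedTriple-∈-combinations : ∀ {a b c} → Distinct3 a b c →
                                 derivedTriple a b c ∈ₗ map derivedTripleᵛ (combinations 3 n)
  derivedTriple-∈-combinations {a} {b} {c} abc with combinations-complete (triple a b c) (∣triple∣≡3 abc)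
  ... | x ∷ y ∷ z ∷ [] , v∈ , xyz≡abc =
    subst (_∈ₗ _) (symmetric-respects-triple derivedTriple-symmetric abc (trans (sym (toSubset-triple x y z)) xyz≡abc))
          (∈-map⁺ derivedTripleᵛ v∈)

  derivedTriples≈combinations : ∀ {z} →
    z ∈ₗ map derivedTripleᵗ (distinctTriples S) ⇔ z ∈ₗ map derivedTripleᵛ (combinations 3 n)
  derivedTriples≈combinations = mk⇔ to from
    where
    to : ∀ {z} → z ∈ₗ map derivedTripleᵗ (distinctTriples S) → z ∈ₗ map derivedTripleᵛ (combinations 3 n)
    to z∈ with ∈-map⁻ derivedTripleᵗ z∈
    ... | (a , b , c) , t∈ , refl = derivedTriple-∈-combinations (∈-distinctTriples⁻ t∈)
    from : ∀ {z} → z ∈ₗ map derivedTripleᵛ (combinations 3 n) → z ∈ₗ map derivedTripleᵗ (distinctTriples S)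
    from z∈ with ∈-map⁻ derivedTripleᵛ z∈
    ... | a ∷ b ∷ c ∷ [] , v∈ , refl =
      ∈-map⁺ derivedTripleᵗ (∈-distinctTriples⁺ (Unique⇒Distinct3 (combinations-Unique v∈)))

  module _ (hall : IsHall S) where

    recoveredTriple-derived : ∀ {a b c} → Distinct3 a b c →
                              recoveredTriple (a ⋆ b) (b ⋆ c) (c ⋆ a) ≡ triple a b c
    recoveredTriple-derived (a≢b , b≢c , a≢c) = triple-cong
      (proj₂ (hall-recovers hall (a≢b , b≢c , a≢c)))
      (proj₂ (hall-recovers hall (b≢c , a≢c ∘′ sym , a≢b ∘′ sym)))
      (proj₂ (hall-recovers hall (a≢c ∘′ sym , a≢b , b≢c ∘′ sym)))

    derivedTriple-injective : ∀ {a b c a′ b′ c′} → Distinct3 a b c → Distinct3 a′ b′ c′ →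
      derivedTriple a b c ≡ derivedTriple a′ b′ c′ → triple a b c ≡ triple a′ b′ c′
    derivedTriple-injective {a} {b} {c} {a′} {b′} {c′} abc a′b′c′ eq = begin
      triple a b c                                  ≡⟨ recoveredTriple-derived abc ⟨
      recoveredTriple (a ⋆ b) (b ⋆ c) (c ⋆ a)       ≡⟨ symmetric-respects-triple recoveredTriple-symmetric
                                                         (proj₁ (hall-recovers hall a′b′c′)) eq ⟩
      recoveredTriple (a′ ⋆ b′) (b′ ⋆ c′) (c′ ⋆ a′) ≡⟨ recoveredTriple-derived a′b′c′ ⟩
      triple a′ b′ c′                               ∎
      where open ≡-Reasoning

    derivedTriples-unique : List.Unique (map derivedTripleᵛ (combinations 3 n))
    derivedTriples-unique = AllPairs.map⁺ (AllPairs-map-∈ injective (combinations-toSubset-unique 3 n))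
      where
      injective : ∀ {u v} → u ∈ₗ combinations 3 n → v ∈ₗ combinations 3 n →
                  toSubset u ≢ toSubset v → derivedTripleᵛ u ≢ derivedTripleᵛ v
      injective {a ∷ b ∷ c ∷ []} {a′ ∷ b′ ∷ c′ ∷ []} u∈ v∈ u≢v eq = u≢v (begin
        toSubset (a ∷ b ∷ c ∷ [])    ≡⟨ toSubset-triple a b c ⟩
        triple a b c                 ≡⟨ derivedTriple-injective (Unique⇒Distinct3 (combinations-Unique u∈))
                                                                (Unique⇒Distinct3 (combinations-Unique v∈)) eq ⟩
        triple a′ b′ c′              ≡⟨ toSubset-triple a′ b′ c′ ⟨
        toSubset (a′ ∷ b′ ∷ c′ ∷ []) ∎)
        where open ≡-Reasoning

proposition3p4 : ∀ (n : ℕ) (S : STS n) → IsHall S → StronglyAntiPasch S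
proposition3p4 n S hall = begin
  β S                                                ≡⟨ length-deduplicate (≡-dec _≟ᵇ_) (derivedTriples≈combinations S)
                                                                           (derivedTriples-unique S hall) ⟩
  length (map (derivedTripleᵛ S) (combinations 3 n)) ≡⟨ length-map _ (combinations 3 n) ⟩
  length (combinations 3 n)                          ≡⟨ length-combinations 3 n ⟩
  n C 3                                              ∎
  where open ≡-Reasoning
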